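{- Let $D=(E,\mathcal{F})$ be a set system and $A\subseteq E$. Then ${}^{\partial}w_{D}^{\bullet}(z)={}^{\partial}w_{D^{\bullet|A}}^{\bullet}(z)$ for every $\bullet\in\{*,\times,*\times*\}$.
   Context: A set system is a pair $D=(E,\mathcal{F})$ with $E$ finite and $\mathcal{F}$ a collection of subsets of $E$. The width $w(D)$ is the maximum size minus the minimum size of a feasible set. For $A\subseteq E$, $D^{*|A}=(E,\{A\Delta X:X\in\mathcal{F}\})$. For $e\in E$, $D^{\times|e}=(E,\mathcal{F}\Delta\{F\cup e:F\in\mathcal{F},e\notin F\})$. For a word $a=a_1\cdots a_n$ in $\{*,\times\}$, $D^{a|e}$ means applying $a_1|e$, then $a_2|e$, etc.; and $D^{a|A}$ for $A=\{e_1,\dots,e_m\}$ means applying $a|e_1$, …, $a|e_m$ in turn (operations on distinct elements commute). Thus $*\times*$ on $e$ means twist at $e$, then loop complement at $e$, then twist at $e$. The partial-$\bullet$ polynomial is ${}^{\partial}w_{D}^{\bullet}(z)=\sum_{A\subseteq E}z^{w(D^{\bullet|A})}$. -}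

module Defs where

open import Data.Bool using (Bool; true; false; _xor_; _∧_; if_then_else_)
open import Data.Nat using (ℕ; _∸_; _⊔_; _⊓_; _≡ᵇ_)
open import Data.Fin using (Fin)
open import Data.Fin.Subset using (Subset; ∣_∣)
open import Data.Vec using (Vec; []; _∷_; zipWith; lookup; _[_]≔_; allFin; toList)
open import Data.List using (List; []; _∷_; _++_; map; filter; foldr; length)
open import Data.List as L using ()
open import Relation.Nullary.Decidable using (Dec)
open import Relation.Binary.PropositionalEquality using (_≡_)
open import Data.Bool.Properties using (T?)
open import Data.Bool using (T)

-- A set system on ground set E = Fin n: the family 𝓕 is given by its
-- characteristic function (a subset X of E is feasible iff 𝓕 X ≡ true).
SetSystem : ℕ → Set
SetSystem n = Subset n → Bool

_Δ_ : ∀ {n} → Subset n → Subset n → Subset n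
_Δ_ = zipWith _xor_

allSubsets : (n : ℕ) → List (Subset n)
allSubsets ℕ.zero = [] ∷ []
allSubsets (ℕ.suc n) = map (true ∷_) (allSubsets n) ++ map (false ∷_) (allSubsets n)

feasible : ∀ {n} → SetSystem n → List (Subset n)
feasible {n} D = filter (λ X → T? (D X)) (allSubsets n)

-- width: max size minus min size of a feasible set
-- (sizes are ≤ n, so starting the minimum at n is harmless; for the empty
-- family this gives 0, a convention that does not matter)
maxSize : ∀ {n} → SetSystem n → ℕ
maxSize D = foldr _⊔_ 0 (map ∣_∣ (feasible D))

minSize : ∀ {n} → SetSystem n → ℕ
minSize {n} D = foldr _⊓_ n (map ∣_∣ (feasible D))

width : ∀ {n} → SetSystem n → ℕ
width D = maxSize D ∸ minSize D

-- Twist at A: D^{*|A} = (E, {A Δ X : X ∈ 𝓕});  Y ∈ 𝓕' iff A Δ Y ∈ 𝓕.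
twist : ∀ {n} → Subset n → SetSystem n → SetSystem n
twist A D Y = D (A Δ Y)

singleton : ∀ {n} → Fin n → Subset n
singleton {n} e = Data.Fin.Subset.⁅_⁆ e

twistAt : ∀ {n} → Fin n → SetSystem n → SetSystem n
twistAt e = twist (singleton e)

-- Loop complement at e: 𝓕 Δ {F ∪ e : F ∈ 𝓕, e ∉ F}.
-- Y lies in the second family iff e ∈ Y and Y \ e ∈ 𝓕.
loopComplementAt : ∀ {n} → Fin n → SetSystem n → SetSystem n
loopComplementAt e D Y = D Y xor (lookup Y e ∧ D (Y [ e ]≔ false))

data Op : Set where
  ⋆ : Op
  ✕ : Op

applyOp : ∀ {n} → Op → Fin n → SetSystem n → SetSystem n
applyOp ⋆ = twistAt
applyOp ✕ = loopComplementAt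

-- D^{a|e} for a word a = a₁⋯aₖ: apply a₁|e first, then a₂|e, ...
applyWordAt : ∀ {n} → List Op → Fin n → SetSystem n → SetSystem n
applyWordAt [] e D = D
applyWordAt (a ∷ as) e D = applyWordAt as e (applyOp a e D)

applyWordSet : ∀ {n} → List Op → Subset n → SetSystem n → SetSystem n
applyWordSet {n} w A D =
  L.foldl (λ D' e → applyWordAt w e D') D (filter (λ e → T? (lookup A e)) (toList (allFin n)))

data Bullet : Set where
  star        : Bullet
  times       : Bullet
  starTimesStar : Bullet

word : Bullet → List Op
word star = ⋆ ∷ []
word times = ✕ ∷ []
word starTimesStar = ⋆ ∷ ✕ ∷ ⋆ ∷ []

_^⟨_∣_⟩ : ∀ {n} → SetSystem n → Bullet → Subset n → SetSystem n
D ^⟨ b ∣ A ⟩ = applyWordSet (word b) A D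

-- The partial-• polynomial ∂w_D^•(z) = Σ_{A ⊆ E} z^{w(D^{•|A})},
-- represented by its coefficient sequence: coefficient of z^k is the
-- number of A ⊆ E with w(D^{•|A}) = k.
partialPoly : ∀ {n} → SetSystem n → Bullet → ℕ → ℕ
partialPoly {n} D b k = length (filter (λ A → T? (width (D ^⟨ b ∣ A ⟩) ≡ᵇ k)) (allSubsets n))

{-# OPTIONS --safe #-}
-- For each • and e, the operation D ↦ D^{•|e} is an involution, and the operations at distinct
-- elements commute (for *×* because twists and loop complements at distinct elements commute).
-- Hence (D^{•|A})^{•|B} = D^{•|A Δ B}. Since B ↦ A Δ B permutes the subsets of E, the widths
-- w((D^{•|A})^{•|B}) run over the same multiset as the widths w(D^{•|B}).
module Submission where

open import Defs
open import Data.Nat using (ℕ)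
open import Data.Fin.Subset using (Subset)
open import Relation.Binary.PropositionalEquality using (_≡_)

open import Algebra using (CommutativeRing)
import Algebra.Properties.CommutativeSemigroup as CommutativeSemigroupProperties
open import Data.Bool using (Bool; true; false; _xor_; _∧_; T)
open import Data.Bool.Properties
  using (T?; xor-assoc; xor-same; xor-identityʳ; ∧-distribˡ-xor; xor-∧-commutativeRing)
open import Data.Fin using (Fin; zero; suc; _≟_)
open import Data.Fin.Subset using (⁅_⁆; ∣_∣)
open import Data.List using (List; []; _∷_; _++_; map; filter; length; foldl; foldr)
open import Data.List.Properties using (filter-≐; filter-++; length-++)
open import Data.Nat using (zero; suc; _+_; _∸_; _⊔_; _⊓_; _≡ᵇ_)
open import Data.Nat.Properties using (+-comm)
open import Data.Product using (_,_)
open import Data.Vec using ([]; _∷_; lookup; _[_]≔_; allFin; toList)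
open import Data.Vec.Properties
  using (lookup∘update; lookup∘update′; []≔-commutes; lookup-zipWith; lookup-replicate)
open import Function using (_∘_; id)
open import Relation.Binary.PropositionalEquality
  using (_≢_; ≢-sym; _≗_; refl; sym; trans; cong; cong₂; cong-app; subst; module ≡-Reasoning)
open import Relation.Nullary using (yes; no; contradiction)

open ≡-Reasoning

open CommutativeSemigroupProperties (CommutativeRing.+-commutativeSemigroup xor-∧-commutativeRing)
  using () renaming (interchange to xor-interchange; x∙yz≈y∙xz to xor-left-commute)
open CommutativeSemigroupProperties (CommutativeRing.*-commutativeSemigroup xor-∧-commutativeRing)
  using () renaming (x∙yz≈y∙xz to ∧-left-commute)

xor-cancelˡ : ∀ x y → x xor (x xor y) ≡ y
xor-cancelˡ x y = trans (sym (xor-assoc x x y)) (cong (_xor y) (xor-same x))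

xor-cancelʳ : ∀ x y → (x xor y) xor y ≡ x
xor-cancelʳ x y = trans (xor-assoc x y y) (trans (cong (x xor_) (xor-same y)) (xor-identityʳ x))

-- Both sides expand to d ⊕ z a ⊕ y b ⊕ y z c.
xor-∧-exchange : ∀ d a b c y z →
  (d xor (z ∧ a)) xor (y ∧ (b xor (z ∧ c))) ≡ (d xor (y ∧ b)) xor (z ∧ (a xor (y ∧ c)))
xor-∧-exchange d a b c y z = begin
  (d xor (z ∧ a)) xor (y ∧ (b xor (z ∧ c)))
    ≡⟨ cong ((d xor (z ∧ a)) xor_) (∧-distribˡ-xor y b (z ∧ c)) ⟩
  (d xor (z ∧ a)) xor ((y ∧ b) xor (y ∧ (z ∧ c)))
    ≡⟨ xor-interchange d (z ∧ a) (y ∧ b) (y ∧ (z ∧ c)) ⟩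
  (d xor (y ∧ b)) xor ((z ∧ a) xor (y ∧ (z ∧ c)))
    ≡⟨ cong (λ t → (d xor (y ∧ b)) xor ((z ∧ a) xor t)) (∧-left-commute y z c) ⟩
  (d xor (y ∧ b)) xor ((z ∧ a) xor (z ∧ (y ∧ c)))
    ≡⟨ cong ((d xor (y ∧ b)) xor_) (sym (∧-distribˡ-xor z a (y ∧ c))) ⟩
  (d xor (y ∧ b)) xor (z ∧ (a xor (y ∧ c))) ∎

Δ-cancelˡ : ∀ {n} (A Y : Subset n) → A Δ (A Δ Y) ≡ Y
Δ-cancelˡ []      []      = refl
Δ-cancelˡ (a ∷ A) (y ∷ Y) = cong₂ _∷_ (xor-cancelˡ a y) (Δ-cancelˡ A Y)

Δ-left-commute : ∀ {n} (A B Y : Subset n) → A Δ (B Δ Y) ≡ B Δ (A Δ Y)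
Δ-left-commute []      []      []      = refl
Δ-left-commute (a ∷ A) (b ∷ B) (y ∷ Y) = cong₂ _∷_ (xor-left-commute a b y) (Δ-left-commute A B Y)

lookup-⁅⁆-≢ : ∀ {n} {e f : Fin n} → e ≢ f → lookup ⁅ e ⁆ f ≡ false
lookup-⁅⁆-≢ {e = zero}  {zero}  e≢f = contradiction refl e≢f
lookup-⁅⁆-≢ {e = zero}  {suc f} _   = lookup-replicate f false
lookup-⁅⁆-≢ {e = suc e} {zero}  _   = refl
lookup-⁅⁆-≢ {e = suc e} {suc f} e≢f = lookup-⁅⁆-≢ (e≢f ∘ cong suc)

lookup-Δ-outside : ∀ {n} (A Y : Subset n) f → lookup A f ≡ false → lookup (A Δ Y) f ≡ lookup Y f
lookup-Δ-outside A Y f f∉A = trans (lookup-zipWith _xor_ f A Y) (cong (_xor lookup Y f) f∉A)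

[]≔-Δ-outside : ∀ {n} (A Y : Subset n) f → lookup A f ≡ false →
  (A Δ Y) [ f ]≔ false ≡ A Δ (Y [ f ]≔ false)
[]≔-Δ-outside (a ∷ A) (y ∷ Y) zero    refl = refl
[]≔-Δ-outside (a ∷ A) (y ∷ Y) (suc f) f∉A  = cong ((a xor y) ∷_) ([]≔-Δ-outside A Y f f∉A)

Operator : ℕ → Set
Operator n = SetSystem n → SetSystem n

Congruent : ∀ {n} → Operator n → Set
Congruent φ = ∀ {D D′} → D ≗ D′ → φ D ≗ φ D′

Involutive : ∀ {n} → Operator n → Set
Involutive φ = ∀ D → φ (φ D) ≗ D

record Commute {n} (φ ψ : Operator n) : Set where
  field commute : ∀ D → φ (ψ D) ≗ ψ (φ D)

open Commute

commute-sym : ∀ {n} {φ ψ : Operator n} → Commute φ ψ → Commute ψ φ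
commute-sym φψ .commute D Y = sym (commute φψ D Y)

commute-∘ : ∀ {n} {φ ψ χ : Operator n} → Congruent ψ →
  Commute φ ψ → Commute φ χ → Commute φ (ψ ∘ χ)
commute-∘ {χ = χ} ψ-cong φψ φχ .commute D Y = trans (commute φψ (χ D) Y) (ψ-cong (commute φχ D) Y)

commute-conjugate : ∀ {n} {φ ψ χ : Operator n} → Congruent ψ → Congruent χ →
  Commute φ ψ → Commute φ χ → Commute φ (ψ ∘ χ ∘ ψ)
commute-conjugate ψ-cong χ-cong φψ φχ = commute-∘ ψ-cong φψ (commute-∘ χ-cong φχ φψ)

involutive-conjugate : ∀ {n} {φ ψ : Operator n} → Congruent φ → Congruent ψ →
  Involutive φ → Involutive ψ → Involutive (φ ∘ ψ ∘ φ)
involutive-conjugate {φ = φ} {ψ} φ-cong ψ-cong φ-inv ψ-inv D Y = begin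
  φ (ψ (φ (φ (ψ (φ D))))) Y ≡⟨ φ-cong (ψ-cong (φ-inv (ψ (φ D)))) Y ⟩
  φ (ψ (ψ (φ D))) Y         ≡⟨ φ-cong (ψ-inv (φ D)) Y ⟩
  φ (φ D) Y                 ≡⟨ φ-inv D Y ⟩
  D Y                       ∎

twistAt-cong : ∀ {n} (e : Fin n) → Congruent (twistAt e)
twistAt-cong e D≗D′ Y = D≗D′ (⁅ e ⁆ Δ Y)

loopComplementAt-cong : ∀ {n} (e : Fin n) → Congruent (loopComplementAt e)
loopComplementAt-cong e D≗D′ Y = cong₂ _xor_ (D≗D′ Y) (cong (lookup Y e ∧_) (D≗D′ (Y [ e ]≔ false)))

applyOp-cong : ∀ {n} o (e : Fin n) → Congruent (applyOp o e)
applyOp-cong ⋆ = twistAt-cong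
applyOp-cong ✕ = loopComplementAt-cong

applyWordAt-cong : ∀ {n} w (e : Fin n) → Congruent (applyWordAt w e)
applyWordAt-cong []      e D≗D′ = D≗D′
applyWordAt-cong (o ∷ w) e D≗D′ = applyWordAt-cong w e (applyOp-cong o e D≗D′)

twistAt-involutive : ∀ {n} (e : Fin n) → Involutive (twistAt e)
twistAt-involutive e D Y = cong D (Δ-cancelˡ ⁅ e ⁆ Y)

loopComplementAt-involutive : ∀ {n} (e : Fin n) → Involutive (loopComplementAt e)
loopComplementAt-involutive e D Y = begin
  (d xor (y ∧ b)) xor (y ∧ (b xor (lookup Y₀ e ∧ D (Y₀ [ e ]≔ false))))
    ≡⟨ cong (λ u → (d xor (y ∧ b)) xor (y ∧ (b xor (u ∧ D (Y₀ [ e ]≔ false))))) (lookup∘update e Y false) ⟩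
  (d xor (y ∧ b)) xor (y ∧ (b xor false))
    ≡⟨ cong (λ t → (d xor (y ∧ b)) xor (y ∧ t)) (xor-identityʳ b) ⟩
  (d xor (y ∧ b)) xor (y ∧ b)
    ≡⟨ xor-cancelʳ d (y ∧ b) ⟩
  d ∎
  where
  Y₀ = Y [ e ]≔ false
  y  = lookup Y e
  d  = D Y
  b  = D Y₀

twistAt-commute : ∀ {n} (e f : Fin n) → Commute (twistAt e) (twistAt f)
twistAt-commute e f .commute D Y = cong D (Δ-left-commute ⁅ f ⁆ ⁅ e ⁆ Y)

twistAt-loopComplementAt-commute : ∀ {n} {e f : Fin n} → e ≢ f →
  Commute (twistAt e) (loopComplementAt f)
twistAt-loopComplementAt-commute {e = e} {f} e≢f .commute D Y =
  cong₂ (λ u V → D (⁅ e ⁆ Δ Y) xor (u ∧ D V))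
    (lookup-Δ-outside ⁅ e ⁆ Y f f∉⁅e⁆)
    ([]≔-Δ-outside ⁅ e ⁆ Y f f∉⁅e⁆)
  where f∉⁅e⁆ = lookup-⁅⁆-≢ e≢f

loopComplementAt-commute : ∀ {n} {e f : Fin n} → e ≢ f →
  Commute (loopComplementAt e) (loopComplementAt f)
loopComplementAt-commute {e = e} {f} e≢f .commute D Y = begin
  (d xor (z ∧ a)) xor (y ∧ (b xor (lookup Yᵉ f ∧ D (Yᵉ [ f ]≔ false))))
    ≡⟨ cong₂ (λ u V → (d xor (z ∧ a)) xor (y ∧ (b xor (u ∧ D V))))
             (lookup∘update′ (≢-sym e≢f) Y false) ([]≔-commutes Y e f e≢f) ⟩
  (d xor (z ∧ a)) xor (y ∧ (b xor (z ∧ c)))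
    ≡⟨ xor-∧-exchange d a b c y z ⟩
  (d xor (y ∧ b)) xor (z ∧ (a xor (y ∧ c)))
    ≡⟨ cong (λ u → (d xor (y ∧ b)) xor (z ∧ (a xor (u ∧ c)))) (sym (lookup∘update′ e≢f Y false)) ⟩
  (d xor (y ∧ b)) xor (z ∧ (a xor (lookup Yᶠ e ∧ c))) ∎
  where
  Yᵉ = Y [ e ]≔ false
  Yᶠ = Y [ f ]≔ false
  y = lookup Y e
  z = lookup Y f
  d = D Y
  a = D Yᶠ
  b = D Yᵉ
  c = D (Yᶠ [ e ]≔ false)

bulletAt : ∀ {n} → Bullet → Fin n → Operator n
bulletAt b = applyWordAt (word b)

bulletAt-cong : ∀ {n} b (e : Fin n) → Congruent (bulletAt b e)
bulletAt-cong b = applyWordAt-cong (word b)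

bulletAt-involutive : ∀ {n} b (e : Fin n) → Involutive (bulletAt b e)
bulletAt-involutive star          e = twistAt-involutive e
bulletAt-involutive times         e = loopComplementAt-involutive e
bulletAt-involutive starTimesStar e =
  involutive-conjugate {φ = twistAt e} {loopComplementAt e}
    (twistAt-cong e) (loopComplementAt-cong e) (twistAt-involutive e) (loopComplementAt-involutive e)

bulletAt-commute-≢ : ∀ {n} b {e f : Fin n} → e ≢ f → Commute (bulletAt b e) (bulletAt b f)
bulletAt-commute-≢ star          {e} {f} e≢f = twistAt-commute e f
bulletAt-commute-≢ times                 e≢f = loopComplementAt-commute e≢f
bulletAt-commute-≢ starTimesStar {e} {f} e≢f =
  commute-conjugate (twistAt-cong f) (loopComplementAt-cong f) Sₑ-twist Sₑ-loop
  where
  Sₑ = bulletAt starTimesStar e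
  Sₑ-twist : Commute Sₑ (twistAt f)
  Sₑ-twist = commute-sym
    (commute-conjugate (twistAt-cong e) (loopComplementAt-cong e)
      (twistAt-commute f e) (twistAt-loopComplementAt-commute (≢-sym e≢f)))
  Sₑ-loop : Commute Sₑ (loopComplementAt f)
  Sₑ-loop = commute-sym
    (commute-conjugate (twistAt-cong e) (loopComplementAt-cong e)
      (commute-sym (twistAt-loopComplementAt-commute e≢f)) (loopComplementAt-commute (≢-sym e≢f)))

bulletAt-commute : ∀ {n} b (e f : Fin n) → Commute (bulletAt b e) (bulletAt b f)
bulletAt-commute b e f with e ≟ f
... | yes refl = record { commute = λ D Y → refl }
... | no  e≢f  = bulletAt-commute-≢ b e≢f

module CommutingInvolutions {n} (op : Fin n → Operator n)
  (op-cong : ∀ e → Congruent (op e))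
  (op-involutive : ∀ e → Involutive (op e))
  (op-commute : ∀ e f → Commute (op e) (op f)) where

  applyIf : Bool → Fin n → Operator n
  applyIf true  e = op e
  applyIf false e = id

  applyOn : List (Fin n) → Subset n → Operator n
  applyOn []       A D = D
  applyOn (e ∷ es) A D = applyOn es A (applyIf (lookup A e) e D)

  foldl-filter≡applyOn : ∀ es A D →
    foldl (λ D′ e → op e D′) D (filter (λ e → T? (lookup A e)) es) ≡ applyOn es A D
  foldl-filter≡applyOn []       A D = refl
  foldl-filter≡applyOn (e ∷ es) A D with lookup A e
  ... | true  = foldl-filter≡applyOn es A (op e D)
  ... | false = foldl-filter≡applyOn es A D

  applyIf-cong : ∀ b e → Congruent (applyIf b e)
  applyIf-cong true  e = op-cong e
  applyIf-cong false e D≗D′ = D≗D′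

  applyOn-cong : ∀ es A → Congruent (applyOn es A)
  applyOn-cong []       A D≗D′ = D≗D′
  applyOn-cong (e ∷ es) A D≗D′ = applyOn-cong es A (applyIf-cong (lookup A e) e D≗D′)

  applyIf-commute : ∀ b c e f → Commute (applyIf b e) (applyIf c f)
  applyIf-commute true  true  e f = op-commute e f
  applyIf-commute true  false e f .commute D Y = refl
  applyIf-commute false c     e f .commute D Y = refl

  applyOn-commute : ∀ es A c f → Commute (applyOn es A) (applyIf c f)
  applyOn-commute []       A c f .commute D Y = refl
  applyOn-commute (e ∷ es) A c f .commute D Y =
    trans (applyOn-cong es A (commute (applyIf-commute (lookup A e) c e f) D) Y)
          (commute (applyOn-commute es A c f) (applyIf (lookup A e) e D) Y)

  applyIf-twice : ∀ b c e D → applyIf c e (applyIf b e D) ≗ applyIf (b xor c) e D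
  applyIf-twice true  true  e D   = op-involutive e D
  applyIf-twice true  false e D Y = refl
  applyIf-twice false c     e D Y = refl

  applyOn-Δ : ∀ es A B D → applyOn es B (applyOn es A D) ≗ applyOn es (A Δ B) D
  applyOn-Δ []       A B D Y = refl
  applyOn-Δ (e ∷ es) A B D Y = begin
    applyOn es B (applyIf b e (applyOn es A (applyIf a e D))) Y
      ≡⟨ applyOn-cong es B (commute (commute-sym (applyOn-commute es A b e)) (applyIf a e D)) Y ⟩
    applyOn es B (applyOn es A (applyIf b e (applyIf a e D))) Y
      ≡⟨ applyOn-Δ es A B (applyIf b e (applyIf a e D)) Y ⟩
    applyOn es (A Δ B) (applyIf b e (applyIf a e D)) Y
      ≡⟨ applyOn-cong es (A Δ B) (applyIf-twice a b e D) Y ⟩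
    applyOn es (A Δ B) (applyIf (a xor b) e D) Y
      ≡⟨ cong (λ c → applyOn es (A Δ B) (applyIf c e D) Y) (sym (lookup-zipWith _xor_ e A B)) ⟩
    applyOn es (A Δ B) (applyIf (lookup (A Δ B) e) e D) Y ∎
    where
    a = lookup A e
    b = lookup B e

^⟨∣⟩-Δ : ∀ {n} (D : SetSystem n) b (A B : Subset n) →
  (D ^⟨ b ∣ A ⟩) ^⟨ b ∣ B ⟩ ≗ D ^⟨ b ∣ A Δ B ⟩
^⟨∣⟩-Δ {n} D b A B Y = begin
  ((D ^⟨ b ∣ A ⟩) ^⟨ b ∣ B ⟩) Y       ≡⟨ cong-app (foldl-filter≡applyOn es B (D ^⟨ b ∣ A ⟩)) Y ⟩
  applyOn es B (D ^⟨ b ∣ A ⟩) Y       ≡⟨ cong (λ E → applyOn es B E Y) (foldl-filter≡applyOn es A D) ⟩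
  applyOn es B (applyOn es A D) Y     ≡⟨ applyOn-Δ es A B D Y ⟩
  applyOn es (A Δ B) D Y              ≡⟨ cong-app (foldl-filter≡applyOn es (A Δ B) D) Y ⟨
  (D ^⟨ b ∣ A Δ B ⟩) Y                ∎
  where
  open CommutingInvolutions (bulletAt b) (bulletAt-cong b) (bulletAt-involutive b) (bulletAt-commute b)
  es = toList (allFin n)

filterᵇ-cong : ∀ {X : Set} {p q : X → Bool} → p ≗ q → ∀ xs →
  filter (λ x → T? (p x)) xs ≡ filter (λ x → T? (q x)) xs
filterᵇ-cong {p = p} {q} p≗q =
  filter-≐ (λ x → T? (p x)) (λ x → T? (q x)) ((λ {x} → subst T (p≗q x)) , (λ {x} → subst T (sym (p≗q x))))

width-cong : ∀ {n} {D D′ : SetSystem n} → D ≗ D′ → width D ≡ width D′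
width-cong {n} D≗D′ =
  cong (λ F → foldr _⊔_ 0 (map ∣_∣ F) ∸ foldr _⊓_ n (map ∣_∣ F)) (filterᵇ-cong D≗D′ (allSubsets n))

count : ∀ {X : Set} → (X → Bool) → List X → ℕ
count p xs = length (filter (λ x → T? (p x)) xs)

count-cong : ∀ {X : Set} {p q : X → Bool} → p ≗ q → ∀ xs → count p xs ≡ count q xs
count-cong p≗q xs = cong length (filterᵇ-cong p≗q xs)

count-++ : ∀ {X : Set} (p : X → Bool) xs ys → count p (xs ++ ys) ≡ count p xs + count p ys
count-++ p xs ys = trans (cong length (filter-++ (λ x → T? (p x)) xs ys)) (length-++ (filter (λ x → T? (p x)) xs))

count-map : ∀ {X Z : Set} (p : Z → Bool) (g : X → Z) xs → count p (map g xs) ≡ count (p ∘ g) xs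
count-map p g []       = refl
count-map p g (x ∷ xs) with p (g x)
... | true  = cong suc (count-map p g xs)
... | false = count-map p g xs

count-allSubsets-suc : ∀ n (p : Subset (suc n) → Bool) →
  count p (allSubsets (suc n)) ≡ count (p ∘ (true ∷_)) (allSubsets n) + count (p ∘ (false ∷_)) (allSubsets n)
count-allSubsets-suc n p =
  trans (count-++ p (map (true ∷_) (allSubsets n)) (map (false ∷_) (allSubsets n)))
        (cong₂ _+_ (count-map p (true ∷_) (allSubsets n)) (count-map p (false ∷_) (allSubsets n)))

+-xor-translation : ∀ a (h : Bool → ℕ) → h (a xor true) + h (a xor false) ≡ h true + h false
+-xor-translation true  h = +-comm (h false) (h true)
+-xor-translation false h = refl

count-allSubsets-Δ : ∀ n (A : Subset n) (p : Subset n → Bool) →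
  count (λ X → p (A Δ X)) (allSubsets n) ≡ count p (allSubsets n)
count-allSubsets-Δ zero    []      p = count-cong {p = λ X → p ([] Δ X)} {p} (λ { [] → refl }) (allSubsets zero)
count-allSubsets-Δ (suc n) (a ∷ A) p = begin
  count (λ X → p ((a ∷ A) Δ X)) (allSubsets (suc n))
    ≡⟨ count-allSubsets-suc n (λ X → p ((a ∷ A) Δ X)) ⟩
  count (λ X → p ((a xor true) ∷ (A Δ X))) S + count (λ X → p ((a xor false) ∷ (A Δ X))) S
    ≡⟨ cong₂ _+_ (count-allSubsets-Δ n A _) (count-allSubsets-Δ n A _) ⟩
  count (λ X → p ((a xor true) ∷ X)) S + count (λ X → p ((a xor false) ∷ X)) S
    ≡⟨ +-xor-translation a (λ c → count (λ X → p (c ∷ X)) S) ⟩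
  count (p ∘ (true ∷_)) S + count (p ∘ (false ∷_)) S
    ≡⟨ count-allSubsets-suc n p ⟨
  count p (allSubsets (suc n)) ∎
  where S = allSubsets n

mainTheorem2 : (n : ℕ) (D : SetSystem n) (A : Subset n) (b : Bullet) (k : ℕ) →
    partialPoly D b k ≡ partialPoly (D ^⟨ b ∣ A ⟩) b k
mainTheorem2 n D A b k = begin
  count (λ B → width (D ^⟨ b ∣ B ⟩) ≡ᵇ k) (allSubsets n)
    ≡⟨ count-allSubsets-Δ n A (λ B → width (D ^⟨ b ∣ B ⟩) ≡ᵇ k) ⟨
  count (λ B → width (D ^⟨ b ∣ A Δ B ⟩) ≡ᵇ k) (allSubsets n)
    ≡⟨ count-cong (λ B → cong (_≡ᵇ k) (width-cong (^⟨∣⟩-Δ D b A B))) (allSubsets n) ⟨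
  count (λ B → width ((D ^⟨ b ∣ A ⟩) ^⟨ b ∣ B ⟩) ≡ᵇ k) (allSubsets n) ∎
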